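{- Let $n\geq 2$ and $m\geq 1$ be integers with $m<n/2$. Then the graph $K_n^{1/m}$ is not locatable (the robber wins).
   Context: For a graph $G$ and positive integer $m$, $G^{1/m}$ denotes the graph obtained from $G$ by replacing each edge by a path of length $m$ through $m-1$ new vertices. The Robber Locating game on a finite connected graph: a robber occupies an (initially unknown) vertex. In each round the robber first either stays or moves to an adjacent vertex, and then the cop probes any vertex $v$ and is told the current distance from $v$ to the robber; there is no further restriction on the robber's moves. The cop wins if at some point she can determine the robber's current vertex uniquely. The robber is omniscient. A graph is locatable if the cop has a strategy guaranteed to win within a bounded number of rounds, equivalently one that wins against every robber behaviour. -}

module Defs where

open import Data.Nat using (ℕ; zero; suc; _∸_; _≤_)
open import Data.Fin using (Fin; toℕ; inject)
open import Data.List using (List; []; _∷_)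
open import Data.Product using (Σ; ∃; _×_)
open import Data.Sum using (_⊎_)
open import Relation.Binary.PropositionalEquality using (_≡_)

record Graph : Set₁ where
  field
    V   : Set
    Adj : V → V → Set
open Graph public

module _ (G : Graph) where
  data Walk : V G → V G → ℕ → Set where
    here : ∀ {u} → Walk u u 0
    step : ∀ {u w v d} → Adj G u w → Walk w v d → Walk u v (suc d)

  Dist : V G → V G → ℕ → Set
  Dist u v d = Walk u v d × (∀ d' → Walk u v d' → d ≤ d')

  -- a robber behaviour: r 0 is the initial (unknown) vertex, r t the
  -- robber's vertex in round t ≥ 1; each round he stays or moves along an edge
  IsRobberWalk : (ℕ → V G) → Set
  IsRobberWalk r = ∀ t → r (suc t) ≡ r t ⊎ Adj G (r t) (r (suc t))

  -- a (deterministic) cop strategy: the vertex to probe, as a function of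
  -- the answers received so far (most recent answer first)
  CopStrategy : Set
  CopStrategy = List ℕ → V G

  -- Resp σ r t as : "as" is the list of answers of rounds t, t-1, ..., 1
  -- when the cop plays σ against the robber behaviour r.
  data Resp (σ : CopStrategy) (r : ℕ → V G) : ℕ → List ℕ → Set where
    none : Resp σ r 0 []
    next : ∀ {t as a} → Resp σ r t as → Dist (σ as) (r (suc t)) a →
           Resp σ r (suc t) (a ∷ as)

  CopWinsAt : CopStrategy → (ℕ → V G) → ℕ → Set
  CopWinsAt σ r t = ∀ as → Resp σ r t as →
                    ∀ r' → IsRobberWalk r' → Resp σ r' t as → r' t ≡ r t

  Locatable : Set
  Locatable = Σ CopStrategy λ σ → Σ ℕ λ T →
              ∀ r → IsRobberWalk r → ∃ λ t → t ≤ T × CopWinsAt σ r t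

-- Vertices: the n original vertices, and for each pair
-- i < j (encoded as j : Fin n, i : Fin (toℕ j), original vertex inject i) the
-- m-1 internal vertices of the path from i to j; mid j i k is at distance
-- k+1 from i along that path.
data KSubV (n m : ℕ) : Set where
  orig : Fin n → KSubV n m
  mid  : (j : Fin n) → (i : Fin (toℕ j)) → Fin (m ∸ 1) → KSubV n m

data KSubStep (n m : ℕ) : KSubV n m → KSubV n m → Set where
  direct : ∀ {j : Fin n} {i : Fin (toℕ j)} → m ≡ 1 →
           KSubStep n m (orig (inject i)) (orig j)
  first  : ∀ {j : Fin n} {i : Fin (toℕ j)} (k : Fin (m ∸ 1)) → toℕ k ≡ 0 →
           KSubStep n m (orig (inject i)) (mid j i k)
  inner  : ∀ {j : Fin n} {i : Fin (toℕ j)} (k k' : Fin (m ∸ 1)) →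
           toℕ k' ≡ suc (toℕ k) → KSubStep n m (mid j i k) (mid j i k')
  last   : ∀ {j : Fin n} {i : Fin (toℕ j)} (k : Fin (m ∸ 1)) →
           suc (toℕ k) ≡ m ∸ 1 → KSubStep n m (mid j i k) (orig j)

KSub : ℕ → ℕ → Graph
KSub n m = record { V = KSubV n m
                  ; Adj = λ x y → KSubStep n m x y ⊎ KSubStep n m y x }

module Submission where

-- The robber's strategy exploits the symmetry of K_n: swapping two original
-- vertices u, v is an automorphism of K_n^{1/m}, and it fixes a probed
-- vertex p unless u or v is an end of the subdivided edge containing p.  So
-- a probe cannot separate robbers whose situations differ only by such a
-- swap.  The robber keeps, after every round, two explanations of all
-- answers with different current positions:
--  * parked at two distinct original vertices; if the probe touches neither,
--    both stay;
--  * otherwise the robber leaves a touched original vertex x along one of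
--    the n-1 edges at x, keeping open every target y untouched by the probes
--    so far.  Each probe rules out at most two targets, and 2m < n leaves at
--    least two of them (or one, plus the option of turning back to x halfway,
--    which the probes cannot detect by the reflection symmetry of the edge)
--    when the robber arrives, m rounds later.

open import Defs
open import Data.Nat as ℕ using (ℕ; zero; suc; _+_; _*_; _∸_; _⊓_; _≤_; _<_; z≤n; s≤s)
import Data.Nat.Properties as ℕP
open import Data.Fin using (Fin; toℕ; inject; fromℕ<; opposite)
open import Data.Fin.Properties
  using (toℕ-injective; toℕ-inject; toℕ-fromℕ<; toℕ<n; opposite-prop; opposite-involutive; any?)
  renaming (_≟_ to _≟F_)
open import Data.Fin.Permutation.Components using (transpose)
open import Data.Product using (Σ; _×_; _,_; proj₁; proj₂; map₂)
open import Data.Sum using (_⊎_; inj₁; inj₂; [_,_])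
open import Data.List using (List; []; _∷_; length; filter; allFin)
open import Data.List.Properties using (filter-all; length-tabulate)
open import Data.List.Membership.Propositional using (_∈_)
open import Data.List.Membership.Propositional.Properties using (∈-filter⁻)
open import Data.List.Relation.Unary.Any using (here; there)
open import Data.List.Relation.Unary.All as All using (All; []; _∷_)
import Data.List.Relation.Unary.All.Properties as All
open import Data.List.Relation.Unary.AllPairs using ([]; _∷_)
open import Data.List.Relation.Unary.Unique.Propositional using (Unique)
import Data.List.Relation.Unary.Unique.Propositional.Properties as Unique
open import Function using (_∘_; _∘′_)
open import Relation.Nullary using (¬_; Dec; yes; no; ¬?; contradiction)
open import Relation.Nullary.Decidable using (_×-dec_; _⊎-dec_; dec-true; dec-false)
open import Relation.Binary using (DecidableEquality; tri<; tri≈; tri>)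
open import Relation.Binary.PropositionalEquality
  using (_≡_; _≢_; ≢-sym; refl; sym; trans; cong; cong₂; subst; subst₂; module ≡-Reasoning)

least : (P : ℕ → Set) → (∀ d → Dec (P d)) → ∀ k → P k →
        Σ ℕ λ d → P d × (∀ d' → P d' → d ≤ d')
least P P? zero p0 = 0 , p0 , λ _ _ → z≤n
least P P? (suc k) pk with P? 0
... | yes p0 = 0 , p0 , λ _ _ → z≤n
... | no ¬p0 with least (P ∘ suc) (P? ∘ suc) k pk
...   | d , pd , minimal = suc d , pd , λ where
          zero p     → contradiction p ¬p0
          (suc d') p → s≤s (minimal d' p)

module GraphFacts (G : Graph) where

  Move : V G → V G → Set
  Move x y = y ≡ x ⊎ Adj G x y

  _++ᵂ_ : ∀ {u w v d e} → Walk G u w d → Walk G w v e → Walk G u v (d + e)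
  here     ++ᵂ q = q
  step a p ++ᵂ q = step a (p ++ᵂ q)

  reverseᵂ : (∀ {x y} → Adj G x y → Adj G y x) →
             ∀ {u v d} → Walk G u v d → Walk G v u d
  reverseᵂ adj-sym here = here
  reverseᵂ adj-sym {d = suc d} (step a p) =
    subst (Walk G _ _) (ℕP.+-comm d 1) (reverseᵂ adj-sym p ++ᵂ step (adj-sym a) here)

  -- An involutive map preserving adjacency is an automorphism, hence it
  -- preserves distances.
  Dist-invariant : (f : V G → V G) → (∀ {x y} → Adj G x y → Adj G (f x) (f y)) →
                   (∀ x → f (f x) ≡ x) →
                   ∀ {p q d} → Dist G p q d → Dist G (f p) (f q) d
  Dist-invariant f f-adj f-invol {p} {q} (w , shortest) =
    mapᵂ w , λ d' w' → shortest d' (subst₂ (λ x y → Walk G x y d') (f-invol p) (f-invol q) (mapᵂ w'))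
    where
    mapᵂ : ∀ {x y d} → Walk G x y d → Walk G (f x) (f y) d
    mapᵂ here       = here
    mapᵂ (step a w) = step (f-adj a) (mapᵂ w)

  module Distances (_≟_ : DecidableEquality (V G))
                   (adj? : ∀ x y → Dec (Adj G x y))
                   (exists? : (P : V G → Set) → (∀ v → Dec (P v)) → Dec (Σ (V G) P)) where

    walk? : ∀ u v d → Dec (Walk G u v d)
    walk? u v zero with u ≟ v
    ... | yes refl = yes here
    ... | no u≢v   = no λ { here → u≢v refl }
    walk? u v (suc d) with exists? (λ w → Adj G u w × Walk G w v d) (λ w → adj? u w ×-dec walk? w v d)
    ... | yes (w , a , p) = yes (step a p)
    ... | no ¬walk        = no λ { (step a p) → ¬walk (_ , a , p) }

    distance : ∀ {u v k} → Walk G u v k → Σ ℕ (Dist G u v)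
    distance {u} {v} {k} p = least (Walk G u v) (walk? u v) k p

  extendᵂ : ∀ {u v w d} → Walk G u v d → Move v w → Σ ℕ (Walk G u w)
  extendᵂ p (inj₁ refl) = _ , p
  extendᵂ p (inj₂ a)    = _ , p ++ᵂ step a here

  -- The robber path that follows w up to time s and then f (with f 0 = w s).
  switch : (ℕ → V G) → ℕ → (ℕ → V G) → ℕ → V G
  switch w s f t = continue (w t) (t ∸ s)
    where
    continue : V G → ℕ → V G
    continue v zero    = v
    continue v (suc i) = f (suc i)

  switch-before : ∀ w s f {t} → t ≤ s → switch w s f t ≡ w t
  switch-before w s f t≤s rewrite ℕP.m≤n⇒m∸n≡0 t≤s = refl

  switch-after : ∀ w s f → w s ≡ f 0 → ∀ i → switch w s f (s + i) ≡ f i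
  switch-after w s f ws≡f0 zero    rewrite ℕP.+-identityʳ s | ℕP.n∸n≡0 s = ws≡f0
  switch-after w s f ws≡f0 (suc i) rewrite ℕP.m+n∸m≡n s (suc i) = refl

  switch-at : ∀ {w s f t j} → w s ≡ f 0 → t ≡ s + j → switch w s f t ≡ f j
  switch-at {w} {s} {f} {j = j} ws≡f0 refl = switch-after w s f ws≡f0 j

  switch-walk : ∀ {w s f} → IsRobberWalk G w → w s ≡ f 0 → (∀ i → Move (f i) (f (suc i))) →
                IsRobberWalk G (switch w s f)
  switch-walk {w} {s} {f} w-walk ws≡f0 f-moves t with suc t ℕ.≤? s
  ... | yes t<s = subst₂ Move (sym (switch-before w s f (ℕP.<⇒≤ t<s))) (sym (switch-before w s f t<s))
                         (w-walk t)
  ... | no t≮s  = subst (λ t → Move (switch w s f t) (switch w s f (suc t)))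
                        (ℕP.m+[n∸m]≡n (ℕP.≤-pred (ℕP.≰⇒> t≮s))) (moveAfter (t ∸ s))
    where
    moveAfter : ∀ i → Move (switch w s f (s + i)) (switch w s f (suc (s + i)))
    moveAfter i = subst₂ Move (sym (switch-after w s f ws≡f0 i))
                              (sym (switch-at {w = w} {f = f} ws≡f0 (sym (ℕP.+-suc s i))))
                              (f-moves i)

  Resp-cong : ∀ {σ r r' t as} → Resp G σ r t as → (∀ t' → t' ≤ t → r t' ≡ r' t') →
              Resp G σ r' t as
  Resp-cong none _ = none
  Resp-cong {σ} (next {t} {as} {a} rs dd) r≡r' =
    next (Resp-cong rs λ t' t'≤t → r≡r' t' (ℕP.m≤n⇒m≤1+n t'≤t))
         (subst (λ z → Dist G (σ as) z a) (r≡r' (suc t) ℕP.≤-refl) dd)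

  Resp-switch : ∀ {σ w t f as d} → Resp G σ w t as → w t ≡ f 0 → Dist G (σ as) (f 1) d →
                Resp G σ (switch w t f) (suc t) (d ∷ as)
  Resp-switch {σ} {w} {t} {f} {as} {d} resp wt≡f0 dd =
    next (Resp-cong resp λ t' t'≤t → sym (switch-before w t f t'≤t))
         (subst (λ z → Dist G (σ as) z d) (sym (switch-at {w = w} {f = f} wt≡f0 (ℕP.+-comm 1 t))) dd)

∸-suc : ∀ {k t} → t < k → k ∸ t ≡ suc (k ∸ suc t)
∸-suc t<k = ℕP.+-∸-assoc 1 t<k

module Transposition {n : ℕ} (u v : Fin n) where

  transpose-left : transpose u v u ≡ v
  transpose-left rewrite dec-true (u ≟F u) refl = refl

  transpose-right : transpose u v v ≡ u
  transpose-right with v ≟F u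
  ... | yes v≡u = v≡u
  ... | no v≢u rewrite dec-true (v ≟F v) refl = refl

  transpose-other : ∀ {a} → a ≢ u → a ≢ v → transpose u v a ≡ a
  transpose-other {a} a≢u a≢v rewrite dec-false (a ≟F u) a≢u | dec-false (a ≟F v) a≢v = refl

  transpose-involutive : ∀ a → transpose u v (transpose u v a) ≡ a
  transpose-involutive a = byCases (a ≟F u) (a ≟F v)
    where
    byCases : Dec (a ≡ u) → Dec (a ≡ v) → transpose u v (transpose u v a) ≡ a
    byCases (yes refl) _        = trans (cong (transpose u v) transpose-left) transpose-right
    byCases (no _)     (yes refl) = trans (cong (transpose u v) transpose-right) transpose-left
    byCases (no a≢u)   (no a≢v)   = trans (cong (transpose u v) fixed) fixed
      where fixed = transpose-other a≢u a≢v

  transpose-≢ : ∀ {a b} → a ≢ b → transpose u v a ≢ transpose u v b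
  transpose-≢ {a} {b} a≢b e =
    a≢b (trans (sym (transpose-involutive a)) (trans (cong (transpose u v) e) (transpose-involutive b)))

module Candidates {A : Set} (_≟_ : DecidableEquality A) where

  remove : A → List A → List A
  remove c = filter (λ y → ¬? (y ≟ c))

  ∈-remove⁻ : ∀ {y} c L → y ∈ remove c L → y ∈ L × y ≢ c
  ∈-remove⁻ c L = ∈-filter⁻ (λ y → ¬? (y ≟ c)) {xs = L}

  remove-unique : ∀ {c L} → Unique L → Unique (remove c L)
  remove-unique = Unique.filter⁺ (λ y → ¬? (y ≟ _))

  remove-all : ∀ {P : A → Set} {c L} → All P L → All P (remove c L)
  remove-all = All.filter⁺ _

  remove-≢ : ∀ {c} L → All (_≢ c) (remove c L)
  remove-≢ = All.all-filter (λ y → ¬? (y ≟ _))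

  remove-absent : ∀ {c L} → All (_≢ c) L → remove c L ≡ L
  remove-absent = filter-all (λ y → ¬? (y ≟ _))

  remove-length : ∀ {c} L → Unique L → length L ≤ suc (length (remove c L))
  remove-length [] [] = z≤n
  remove-length {c} (z ∷ zs) (z∉zs ∷ zs-unique) with z ≟ c
  ... | yes refl = s≤s (ℕP.≤-reflexive (sym (cong length (remove-absent (All.map ≢-sym z∉zs)))))
  ... | no  _    = s≤s (remove-length zs zs-unique)

  remove₂ : A → A → List A → List A
  remove₂ a b L = remove b (remove a L)

  ∈-remove₂⁻ : ∀ {y} a b L → y ∈ remove₂ a b L → y ∈ L × y ≢ a × y ≢ b
  ∈-remove₂⁻ a b L y∈ with ∈-remove⁻ b (remove a L) y∈
  ... | y∈′ , y≢b with ∈-remove⁻ a L y∈′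
  ...   | y∈L , y≢a = y∈L , y≢a , y≢b

  remove₂-unique : ∀ {a b L} → Unique L → Unique (remove₂ a b L)
  remove₂-unique = remove-unique ∘′ remove-unique

  remove₂-all : ∀ {P : A → Set} {a b L} → All P L → All P (remove₂ a b L)
  remove₂-all pL = remove-all (remove-all pL)

  remove₂-length : ∀ {a b} L → Unique L → length L ≤ 2 + length (remove₂ a b L)
  remove₂-length L L-unique =
    ℕP.≤-trans (remove-length L L-unique) (s≤s (remove-length _ (remove-unique L-unique)))

  remove₂-length-absent : ∀ {a b x} L → Unique L → All (_≢ x) L → x ≡ a ⊎ x ≡ b →
                          length L ≤ 1 + length (remove₂ a b L)
  remove₂-length-absent L L-unique x∉L (inj₁ refl) =
    subst (λ K → length L ≤ 1 + length (remove _ K)) (sym (remove-absent x∉L)) (remove-length L L-unique)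
  remove₂-length-absent L L-unique x∉L (inj₂ refl) =
    subst (λ K → length L ≤ 1 + length K) (sym (remove-absent (remove-all x∉L))) (remove-length L L-unique)

  remove₂-absent : ∀ {a b} L → All (_≢ a) L → All (_≢ b) L → remove₂ a b L ≡ L
  remove₂-absent L a∉L b∉L = trans (remove-absent (remove-all b∉L)) (remove-absent a∉L)

  pickOne : ∀ L → 1 ≤ length L → Σ A (_∈ L)
  pickOne (a ∷ _) _ = a , here refl

  pickTwo : ∀ L → Unique L → 2 ≤ length L →
            Σ A λ y₁ → Σ A λ y₂ → y₁ ∈ L × y₂ ∈ L × y₁ ≢ y₂
  pickTwo (a ∷ b ∷ _) ((a≢b ∷ _) ∷ _) _ = a , b , here refl , there (here refl) , a≢b
  pickTwo (a ∷ []) _ (s≤s ())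

-- The graph K_n^{1/m} for m = M + 1, so that every subdivided edge has M
-- internal vertices (indexed by Fin M, definitionally Fin (m ∸ 1)).
module Subdivision (n M : ℕ) where

  m : ℕ
  m = suc M

  G : Graph
  G = KSub n m

  Vx : Set
  Vx = KSubV n m

  open GraphFacts G public

  orig-injective : ∀ {a b} → _≡_ {A = Vx} (orig a) (orig b) → a ≡ b
  orig-injective refl = refl

  adj-sym : ∀ {x y} → Adj G x y → Adj G y x
  adj-sym (inj₁ s) = inj₂ s
  adj-sym (inj₂ s) = inj₁ s

  move-sym : ∀ {x y} → Move x y → Move y x
  move-sym (inj₁ refl) = inj₁ refl
  move-sym (inj₂ a)    = inj₂ (adj-sym a)

  inject-fromℕ< : ∀ {a b : Fin n} (a<b : toℕ a < toℕ b) → inject {i = b} (fromℕ< a<b) ≡ a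
  inject-fromℕ< a<b = toℕ-injective (trans (toℕ-inject (fromℕ< a<b)) (toℕ-fromℕ< a<b))

  inject< : ∀ {j : Fin n} (i : Fin (toℕ j)) → toℕ (inject i) < toℕ j
  inject< {j} i = subst (_< toℕ j) (sym (toℕ-inject i)) (toℕ<n i)

  fromℕ<-inject : ∀ {j : Fin n} (i : Fin (toℕ j)) → fromℕ< (inject< i) ≡ i
  fromℕ<-inject i = toℕ-injective (trans (toℕ-fromℕ< (inject< i)) (toℕ-inject i))

  inject≢ : ∀ {j : Fin n} (i : Fin (toℕ j)) → inject i ≢ j
  inject≢ i e = ℕP.<-irrefl (cong toℕ e) (inject< i)

  toℕ-≢ : ∀ {a b : Fin n} → a ≢ b → toℕ a ≢ toℕ b
  toℕ-≢ a≢b e = a≢b (toℕ-injective e)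

  at-orig : ∀ {a b : Fin n} {y} (a<b : toℕ a < toℕ b) →
            KSubStep n m (orig (inject {i = b} (fromℕ< a<b))) y → KSubStep n m (orig a) y
  at-orig {y = y} a<b = subst (λ z → KSubStep n m (orig z) y) (inject-fromℕ< a<b)

  _≟V_ : DecidableEquality Vx
  orig a ≟V orig b with a ≟F b
  ... | yes refl = yes refl
  ... | no a≢b   = no λ { refl → a≢b refl }
  orig _ ≟V mid _ _ _ = no λ ()
  mid _ _ _ ≟V orig _ = no λ ()
  mid j i k ≟V mid j' i' k' with j ≟F j'
  ... | no j≢j' = no λ { refl → j≢j' refl }
  ... | yes refl with i ≟F i' | k ≟F k'
  ...   | yes refl | yes refl = yes refl
  ...   | no i≢i'  | _        = no λ { refl → i≢i' refl }
  ...   | yes _    | no k≢k'  = no λ { refl → k≢k' refl }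

  step? : ∀ x y → Dec (KSubStep n m x y)
  step? (orig a) (orig b) with M ℕ.≟ 0 | toℕ a ℕ.<? toℕ b
  ... | yes refl | yes a<b = yes (at-orig a<b (direct refl))
  ... | no M≢0   | _       = no λ { (direct e) → M≢0 (cong ℕ.pred e) }
  ... | yes _    | no a≮b  = no λ { (direct {i = i} _) → a≮b (inject< i) }
  step? (orig a) (mid j i k) with a ≟F inject i | toℕ k ℕ.≟ 0
  ... | yes refl | yes k≡0 = yes (first k k≡0)
  ... | no a≢i   | _       = no λ { (first _ _) → a≢i refl }
  ... | yes _    | no k≢0  = no λ { (first _ e) → k≢0 e }
  step? (mid j i k) (orig b) with b ≟F j | suc (toℕ k) ℕ.≟ M
  ... | yes refl | yes e   = yes (last k e)
  ... | no b≢j   | _       = no λ { (last _ _) → b≢j refl }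
  ... | yes _    | no ¬e   = no λ { (last _ e) → ¬e e }
  step? (mid j i k) (mid j' i' k') with j ≟F j'
  ... | no j≢j' = no λ { (inner _ _ _) → j≢j' refl }
  ... | yes refl with i ≟F i' | toℕ k' ℕ.≟ suc (toℕ k)
  ...   | yes refl | yes e  = yes (inner k k' e)
  ...   | no i≢i'  | _      = no λ { (inner _ _ _) → i≢i' refl }
  ...   | yes _    | no ¬e  = no λ { (inner _ _ e) → ¬e e }

  adj? : ∀ x y → Dec (Adj G x y)
  adj? x y = step? x y ⊎-dec step? y x

  exists? : (P : Vx → Set) → (∀ v → Dec (P v)) → Dec (Σ Vx P)
  exists? P P? with any? (P? ∘ orig) | any? (λ j → any? (λ i → any? (λ k → P? (mid j i k))))
  ... | yes (a , pa) | _                     = yes (orig a , pa)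
  ... | no _         | yes (j , i , k , pk)  = yes (mid j i k , pk)
  ... | no ¬orig     | no ¬mid               = no λ where
    (orig a , pa)    → ¬orig (a , pa)
    (mid j i k , pk) → ¬mid (j , i , k , pk)

  open Distances _≟V_ adj? exists?

  -- interior a b k: the (k+1)-th internal vertex on the subdivided edge,
  -- counted from a towards b (for a ≢ b).
  interior : Fin n → Fin n → Fin M → Vx
  interior a b k with ℕP.<-cmp (toℕ a) (toℕ b)
  ... | tri< a<b _ _ = mid b (fromℕ< a<b) k
  ... | tri≈ _ _ _   = orig a
  ... | tri> _ _ b<a = mid a (fromℕ< b<a) (opposite k)

  interior-< : ∀ {a b k} (a<b : toℕ a < toℕ b) → interior a b k ≡ mid b (fromℕ< a<b) k
  interior-< {a} {b} a<b with ℕP.<-cmp (toℕ a) (toℕ b)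
  ... | tri< _ _ _    = refl
  ... | tri≈ a≮b _ _  = contradiction a<b a≮b
  ... | tri> a≮b _ _  = contradiction a<b a≮b

  interior-> : ∀ {a b k} (b<a : toℕ b < toℕ a) → interior a b k ≡ mid a (fromℕ< b<a) (opposite k)
  interior-> {a} {b} b<a with ℕP.<-cmp (toℕ a) (toℕ b)
  ... | tri< _ _ b≮a = contradiction b<a b≮a
  ... | tri≈ _ _ b≮a = contradiction b<a b≮a
  ... | tri> _ _ _   = refl

  interior-mid : ∀ {j : Fin n} (i : Fin (toℕ j)) k → interior (inject i) j k ≡ mid j i k
  interior-mid {j} i k = trans (interior-< (inject< i)) (cong (λ z → mid j z k) (fromℕ<-inject i))

  interior-flip : ∀ {a b} k → a ≢ b → interior a b k ≡ interior b a (opposite k)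
  interior-flip {a} {b} k a≢b with ℕP.<-cmp (toℕ a) (toℕ b)
  ... | tri< a<b _ _ = sym (trans (interior-> a<b) (cong (mid b (fromℕ< a<b)) (opposite-involutive k)))
  ... | tri≈ _ e _   = contradiction e (toℕ-≢ a≢b)
  ... | tri> _ _ b<a = sym (interior-< b<a)

  ends : Vx → Fin n × Fin n
  ends (orig a)    = a , a
  ends (mid j i k) = inject i , j

  ends-interior : ∀ {a b} k → a ≢ b →
                  (ends (interior a b k) ≡ (a , b)) ⊎ (ends (interior a b k) ≡ (b , a))
  ends-interior {a} {b} k a≢b with ℕP.<-cmp (toℕ a) (toℕ b)
  ... | tri< a<b _ _ = inj₁ (cong (_, b) (inject-fromℕ< a<b))
  ... | tri≈ _ e _   = contradiction e (toℕ-≢ a≢b)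
  ... | tri> _ _ b<a = inj₂ (cong (_, a) (inject-fromℕ< b<a))

  ends-diagonal : M ≡ 0 → ∀ p → proj₁ (ends p) ≡ proj₂ (ends p)
  ends-diagonal _    (orig a)      = refl
  ends-diagonal refl (mid j i ())

  toℕ-opposite : (k : Fin M) → suc (toℕ (opposite k)) ≡ M ∸ toℕ k
  toℕ-opposite k = trans (cong suc (opposite-prop k)) (sym (∸-suc (toℕ<n k)))

  adj-first : ∀ {a b} k → a ≢ b → toℕ k ≡ 0 → Adj G (orig a) (interior a b k)
  adj-first {a} {b} k a≢b k≡0 with ℕP.<-cmp (toℕ a) (toℕ b)
  ... | tri< a<b _ _ = inj₁ (at-orig a<b (first k k≡0))
  ... | tri≈ _ e _   = contradiction e (toℕ-≢ a≢b)
  ... | tri> _ _ b<a = inj₂ (last (opposite k) (trans (toℕ-opposite k) (cong (M ∸_) k≡0)))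

  adj-next : ∀ {a b} k k' → a ≢ b → toℕ k' ≡ suc (toℕ k) → Adj G (interior a b k) (interior a b k')
  adj-next {a} {b} k k' a≢b e with ℕP.<-cmp (toℕ a) (toℕ b)
  ... | tri< a<b _ _ = inj₁ (inner k k' e)
  ... | tri≈ _ e' _  = contradiction e' (toℕ-≢ a≢b)
  ... | tri> _ _ b<a = inj₂ (inner (opposite k') (opposite k)
                              (trans (opposite-prop k) (sym (trans (toℕ-opposite k') (cong (M ∸_) e)))))

  adj-last : ∀ {a b} k → a ≢ b → suc (toℕ k) ≡ M → Adj G (interior a b k) (orig b)
  adj-last {a} {b} k a≢b e with ℕP.<-cmp (toℕ a) (toℕ b)
  ... | tri< a<b _ _ = inj₁ (last k e)
  ... | tri≈ _ e' _  = contradiction e' (toℕ-≢ a≢b)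
  ... | tri> _ _ b<a = inj₂ (at-orig b<a (first (opposite k)
                              (trans (opposite-prop k) (trans (cong (M ∸_) e) (ℕP.n∸n≡0 M)))))

  adj-direct : ∀ {a b : Fin n} → a ≢ b → M ≡ 0 → Adj G (orig a) (orig b)
  adj-direct {a} {b} a≢b M≡0 with ℕP.<-cmp (toℕ a) (toℕ b)
  ... | tri< a<b _ _ = inj₁ (at-orig a<b (direct (cong suc M≡0)))
  ... | tri≈ _ e _   = contradiction e (toℕ-≢ a≢b)
  ... | tri> _ _ b<a = inj₂ (at-orig b<a (direct (cong suc M≡0)))

  -- onPath a b j: the vertex j steps from a along the subdivided edge from a
  -- to b; it is a for j = 0 and b for j ≥ m.
  onPath : Fin n → Fin n → ℕ → Vx
  onPath a b zero    = orig a
  onPath a b (suc j) with j ℕ.<? M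
  ... | yes j<M = interior a b (fromℕ< j<M)
  ... | no  _   = orig b

  onPath-interior : ∀ {a b} k → onPath a b (suc (toℕ k)) ≡ interior a b k
  onPath-interior {a} {b} k with toℕ k ℕ.<? M
  ... | yes k<M = cong (interior a b) (toℕ-injective (toℕ-fromℕ< k<M))
  ... | no  k≮M = contradiction (toℕ<n k) k≮M

  onPath-mid : ∀ {j : Fin n} (i : Fin (toℕ j)) k → onPath (inject i) j (suc (toℕ k)) ≡ mid j i k
  onPath-mid i k = trans (onPath-interior k) (interior-mid i k)

  onPath-beyond : ∀ {a b} j → M ≤ j → onPath a b (suc j) ≡ orig b
  onPath-beyond j M≤j with j ℕ.<? M
  ... | yes j<M = contradiction j<M (ℕP.≤⇒≯ M≤j)
  ... | no  _   = refl

  onPath-end : ∀ {a b} → onPath a b m ≡ orig b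
  onPath-end = onPath-beyond M ℕP.≤-refl

  onPath-step : ∀ {a b} → a ≢ b → ∀ j → Move (onPath a b j) (onPath a b (suc j))
  onPath-step a≢b zero with 0 ℕ.<? M
  ... | yes 0<M = inj₂ (adj-first (fromℕ< 0<M) a≢b (toℕ-fromℕ< 0<M))
  ... | no  0≮M = inj₂ (adj-direct a≢b (ℕP.n≤0⇒n≡0 (ℕP.≮⇒≥ 0≮M)))
  onPath-step a≢b (suc j) with j ℕ.<? M | suc j ℕ.<? M
  ... | yes j<M | yes 1+j<M = inj₂ (adj-next (fromℕ< j<M) (fromℕ< 1+j<M) a≢b
                                  (trans (toℕ-fromℕ< 1+j<M) (cong suc (sym (toℕ-fromℕ< j<M)))))
  ... | yes j<M | no  1+j≮M = inj₂ (adj-last (fromℕ< j<M) a≢b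
                                  (trans (cong suc (toℕ-fromℕ< j<M)) (ℕP.≤-antisym j<M (ℕP.≮⇒≥ 1+j≮M))))
  ... | no  j≮M | yes 1+j<M = contradiction (ℕP.<-trans (ℕP.n<1+n j) 1+j<M) j≮M
  ... | no  _   | no  _     = inj₁ refl

  Near : ℕ → ℕ → Set
  Near i i' = i ≤ suc i' × i' ≤ suc i

  onPath-near : ∀ {a b} → a ≢ b → ∀ {i i'} → Near i i' → Move (onPath a b i) (onPath a b i')
  onPath-near a≢b {i} {i'} (i≤1+i' , i'≤1+i) with ℕP.<-cmp i i'
  ... | tri< i<i' _ _ rewrite ℕP.≤-antisym i'≤1+i i<i' = onPath-step a≢b i
  ... | tri≈ _ refl _ = inj₁ refl
  ... | tri> _ _ i'<i rewrite ℕP.≤-antisym i≤1+i' i'<i = move-sym (onPath-step a≢b i')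

  onPath-reflect : ∀ {a b} → a ≢ b → ∀ j → j ≤ m → onPath a b j ≡ onPath b a (m ∸ j)
  onPath-reflect a≢b zero    _ = sym onPath-end
  onPath-reflect {a} {b} a≢b (suc j) _ with j ℕ.<? M
  ... | yes j<M = begin
        interior a b k                          ≡⟨ interior-flip k a≢b ⟩
        interior b a (opposite k)               ≡⟨ onPath-interior (opposite k) ⟨
        onPath b a (suc (toℕ (opposite k)))     ≡⟨ cong (onPath b a) (toℕ-opposite k) ⟩
        onPath b a (M ∸ toℕ k)                  ≡⟨ cong (λ z → onPath b a (M ∸ z)) (toℕ-fromℕ< j<M) ⟩
        onPath b a (M ∸ j)                      ∎
    where
    open ≡-Reasoning
    k = fromℕ< j<M
  ... | no  j≮M = cong (onPath b a) (sym (ℕP.m≤n⇒m∸n≡0 (ℕP.≮⇒≥ j≮M)))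

  onPath-injective : ∀ {x y₁ y₂} j → 1 ≤ j → j < m → x ≢ y₁ → x ≢ y₂ →
                     onPath x y₁ j ≡ onPath x y₂ j → y₁ ≡ y₂
  onPath-injective {x} {y₁} {y₂} (suc j) _ 1+j<m x≢y₁ x≢y₂ same with j ℕ.<? M
  ... | no  j≮M = contradiction (ℕP.≤-pred 1+j<m) j≮M
  ... | yes j<M = compare (ends-interior k x≢y₁) (ends-interior k x≢y₂)
    where
    k = fromℕ< j<M
    both : ∀ {e₁ e₂} → ends (interior x y₁ k) ≡ e₁ → ends (interior x y₂ k) ≡ e₂ → e₁ ≡ e₂
    both e₁ e₂ = trans (sym e₁) (trans (cong ends same) e₂)
    compare : (ends (interior x y₁ k) ≡ (x , y₁)) ⊎ (ends (interior x y₁ k) ≡ (y₁ , x)) →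
              (ends (interior x y₂ k) ≡ (x , y₂)) ⊎ (ends (interior x y₂ k) ≡ (y₂ , x)) → y₁ ≡ y₂
    compare (inj₁ e₁) (inj₁ e₂) = cong proj₂ (both e₁ e₂)
    compare (inj₁ e₁) (inj₂ e₂) = contradiction (cong proj₁ (both e₁ e₂)) x≢y₂
    compare (inj₂ e₁) (inj₁ e₂) = contradiction (sym (cong proj₁ (both e₁ e₂))) x≢y₁
    compare (inj₂ e₁) (inj₂ e₂) = cong proj₁ (both e₁ e₂)

  walkAlong : ∀ {a b} → a ≢ b → ∀ j k → Σ ℕ (Walk G (onPath a b j) (onPath a b (k + j)))
  walkAlong a≢b j zero    = 0 , here
  walkAlong a≢b j (suc k) = extendᵂ (proj₂ (walkAlong a≢b j k)) (onPath-step a≢b (k + j))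

  toOrig : ∀ v → Σ (Fin n) λ c → Σ ℕ (Walk G v (orig c))
  toOrig (orig a)    = a , 0 , here
  toOrig (mid j i k) = j , subst₂ (λ u w → Σ ℕ (Walk G u w)) (onPath-mid i k)
                                  (onPath-beyond (M + suc (toℕ k)) (ℕP.m≤m+n M _))
                                  (walkAlong (inject≢ i) (suc (toℕ k)) m)

  origWalk : ∀ a b → Σ ℕ (Walk G (orig a) (orig b))
  origWalk a b with a ≟F b
  ... | yes refl = 0 , here
  ... | no  a≢b  = subst (λ z → Σ ℕ (Walk G (orig a) z))
                         (trans (cong (onPath a b) (ℕP.+-identityʳ m)) onPath-end) (walkAlong a≢b 0 m)

  connected : ∀ p q → Σ ℕ (Walk G p q)
  connected p q with toOrig p | toOrig q
  ... | a , _ , p→a | b , _ , q→b = _ , p→a ++ᵂ (proj₂ (origWalk a b) ++ᵂ reverseᵂ adj-sym q→b)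

  dist : ∀ p q → Σ ℕ (Dist G p q)
  dist p q = distance (proj₂ (connected p q))

  -- A transposition of two original vertices induces an involutive
  -- automorphism of K_n^{1/m}; it is the source of all the robber's
  -- indistinguishability arguments.
  module _ (u v : Fin n) where
    open Transposition u v

    swapV : Vx → Vx
    swapV (orig a)    = orig (transpose u v a)
    swapV (mid j i k) = interior (transpose u v (inject i)) (transpose u v j) k

    swap-interior : ∀ {a b} k → a ≢ b →
                    swapV (interior a b k) ≡ interior (transpose u v a) (transpose u v b) k
    swap-interior {a} {b} k a≢b with ℕP.<-cmp (toℕ a) (toℕ b)
    ... | tri< a<b _ _ = cong (λ z → interior (transpose u v z) (transpose u v b) k) (inject-fromℕ< a<b)
    ... | tri≈ _ e _   = contradiction e (toℕ-≢ a≢b)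
    ... | tri> _ _ b<a = begin
          interior (transpose u v (inject (fromℕ< b<a))) (transpose u v a) (opposite k)
            ≡⟨ cong (λ z → interior (transpose u v z) (transpose u v a) (opposite k)) (inject-fromℕ< b<a) ⟩
          interior (transpose u v b) (transpose u v a) (opposite k)
            ≡⟨ interior-flip (opposite k) (transpose-≢ (≢-sym a≢b)) ⟩
          interior (transpose u v a) (transpose u v b) (opposite (opposite k))
            ≡⟨ cong (interior (transpose u v a) (transpose u v b)) (opposite-involutive k) ⟩
          interior (transpose u v a) (transpose u v b) k ∎
      where open ≡-Reasoning

    swap-involutive : ∀ x → swapV (swapV x) ≡ x
    swap-involutive (orig a)    = cong orig (transpose-involutive a)
    swap-involutive (mid j i k) = begin
      swapV (interior (transpose u v (inject i)) (transpose u v j) k)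
        ≡⟨ swap-interior k (transpose-≢ (inject≢ i)) ⟩
      interior (transpose u v (transpose u v (inject i))) (transpose u v (transpose u v j)) k
        ≡⟨ cong₂ (λ a b → interior a b k) (transpose-involutive (inject i)) (transpose-involutive j) ⟩
      interior (inject i) j k
        ≡⟨ interior-mid i k ⟩
      mid j i k ∎
      where open ≡-Reasoning

    swap-onPath : ∀ {a b} → a ≢ b → ∀ j →
                  swapV (onPath a b j) ≡ onPath (transpose u v a) (transpose u v b) j
    swap-onPath a≢b zero = refl
    swap-onPath a≢b (suc j) with j ℕ.<? M
    ... | yes j<M = swap-interior (fromℕ< j<M) a≢b
    ... | no  _   = refl

    swap-adj : ∀ {x y} → Adj G x y → Adj G (swapV x) (swapV y)
    swap-adj = [ forward , adj-sym ∘ forward ]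
      where
      forward : ∀ {x y} → KSubStep n m x y → Adj G (swapV x) (swapV y)
      forward (direct {i = i} e)       = adj-direct (transpose-≢ (inject≢ i)) (cong ℕ.pred e)
      forward (first {i = i} k e)      = adj-first k (transpose-≢ (inject≢ i)) e
      forward (inner {i = i} k k' e)   = adj-next k k' (transpose-≢ (inject≢ i)) e
      forward (last {i = i} k e)       = adj-last k (transpose-≢ (inject≢ i)) e

    Dist-swap : ∀ {p q d} → Dist G p q d → Dist G (swapV p) (swapV q) d
    Dist-swap = Dist-invariant swapV swap-adj swap-involutive

  -- A probe at p cannot tell apart situations exchanged by swapping two
  -- original vertices, provided neither is an end of p's edge.
  Untouched : Fin n → Vx → Set
  Untouched y p = y ≢ proj₁ (ends p) × y ≢ proj₂ (ends p)

  Touched : Fin n → Vx → Set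
  Touched y p = y ≡ proj₁ (ends p) ⊎ y ≡ proj₂ (ends p)

  touched-diagonal : M ≡ 0 → ∀ {y p} → Touched y p → proj₁ (ends p) ≡ y × proj₂ (ends p) ≡ y
  touched-diagonal M≡0 {p = p} (inj₁ y≡e₁) = sym y≡e₁ , trans (sym (ends-diagonal M≡0 p)) (sym y≡e₁)
  touched-diagonal M≡0 {p = p} (inj₂ y≡e₂) = trans (ends-diagonal M≡0 p) (sym y≡e₂) , sym y≡e₂

  touched? : ∀ y p → Touched y p ⊎ Untouched y p
  touched? y p with y ≟F proj₁ (ends p) | y ≟F proj₂ (ends p)
  ... | yes e  | _      = inj₁ (inj₁ e)
  ... | no _   | yes e  = inj₁ (inj₂ e)
  ... | no e₁  | no e₂  = inj₂ (e₁ , e₂)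

  swap-fixes : ∀ {u v} p → Untouched u p → Untouched v p → swapV u v p ≡ p
  swap-fixes {u} {v} (orig a) (u≢a , _) (v≢a , _) = cong orig (transpose-other (≢-sym u≢a) (≢-sym v≢a))
    where open Transposition u v
  swap-fixes {u} {v} (mid j i k) (u≢i , u≢j) (v≢i , v≢j) =
    trans (cong₂ (λ a b → interior a b k) (fixed u≢i v≢i) (fixed u≢j v≢j)) (interior-mid i k)
    where
    open Transposition u v
    fixed : ∀ {a} → u ≢ a → v ≢ a → transpose u v a ≡ a
    fixed u≢a v≢a = transpose-other (≢-sym u≢a) (≢-sym v≢a)

  Dist-untouched : ∀ {u v p q q' d} → Untouched u p → Untouched v p → swapV u v q ≡ q' →
                   Dist G p q d → Dist G p q' d
  Dist-untouched {u} {v} {p} {d = d} u-free v-free swapped pq =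
    subst₂ (λ x y → Dist G x y d) (swap-fixes p u-free v-free) swapped (Dist-swap u v pq)

  Dist-exchange-ends : ∀ {a b p d} → Untouched a p → Untouched b p →
                       Dist G p (orig a) d → Dist G p (orig b) d
  Dist-exchange-ends {a} {b} a-free b-free = Dist-untouched a-free b-free (cong orig (transpose-left))
    where open Transposition a b

  Dist-exchange-target : ∀ {x y₀ y p d} j → x ≢ y₀ → x ≢ y → Untouched y₀ p → Untouched y p →
                         Dist G p (onPath x y₀ j) d → Dist G p (onPath x y j) d
  Dist-exchange-target {x} {y₀} {y} j x≢y₀ x≢y y₀-free y-free =
    Dist-untouched y₀-free y-free
      (trans (swap-onPath y₀ y x≢y₀ j)
             (cong₂ (λ a b → onPath a b j) (transpose-other x≢y₀ x≢y) transpose-left))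
    where open Transposition y₀ y

  Dist-reflect : ∀ {x y p d} j → j ≤ m → x ≢ y → Untouched x p → Untouched y p →
                 Dist G p (onPath x y j) d → Dist G p (onPath x y (m ∸ j)) d
  Dist-reflect {x} {y} j j≤m x≢y x-free y-free =
    Dist-untouched x-free y-free
      (trans (swap-onPath x y x≢y j)
             (trans (cong₂ (λ a b → onPath a b j) transpose-left transpose-right)
                    (onPath-reflect (≢-sym x≢y) j j≤m)))
    where open Transposition x y

-- Candidate counts: 2k+2 candidates, or 2k+1 candidates together with an
-- extra guarantee R.  A probe removes at most two candidates, so each probe
-- costs one unit of k.
Reserve : {A : Set} → ℕ → List A → Set → Set
Reserve k U R = 2 * k + 2 ≤ length U ⊎ (2 * k + 1 ≤ length U × R)

reserve-length : ∀ {A : Set} {k} {U : List A} {R} → Reserve k U R → 2 * k + 1 ≤ length U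
reserve-length {k = k} (inj₁ enough)  = ℕP.≤-trans (ℕP.+-monoʳ-≤ (2 * k) (ℕP.n≤1+n 1)) enough
reserve-length         (inj₂ (enough , _)) = enough

reserve-map : ∀ {A : Set} {k} {U : List A} {R R' : Set} → (R → R') → Reserve k U R → Reserve k U R'
reserve-map f (inj₁ enough)       = inj₁ enough
reserve-map f (inj₂ (enough , r)) = inj₂ (enough , f r)

double-suc : ∀ q c → 2 * suc q + c ≡ 2 + (2 * q + c)
double-suc q c = trans (cong (_+ c) (ℕP.*-suc 2 q)) (ℕP.+-assoc 2 (2 * q) c)

lose-two : ∀ {q c u u'} → 2 * suc q + c ≤ u → u ≤ 2 + u' → 2 * q + c ≤ u'
lose-two {q} {c} before lost = ℕP.+-cancelˡ-≤ 2 _ _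
  (ℕP.≤-trans (ℕP.≤-reflexive (sym (double-suc q c))) (ℕP.≤-trans before lost))

lose-one : ∀ {q u u'} → 2 * suc q + 1 ≤ u → u ≤ 1 + u' → 2 * q + 2 ≤ u'
lose-one {q} before lost = ℕP.+-cancelˡ-≤ 1 _ _
  (ℕP.≤-trans (ℕP.≤-reflexive (trans (cong suc (ℕP.+-suc (2 * q) 1)) (sym (double-suc q 1))))
              (ℕP.≤-trans before lost))

module Robber (n M : ℕ) (2m<n : 2 * suc M < n) (σ : CopStrategy (KSub n (suc M))) where
  open Subdivision n M
  open Candidates (_≟F_ {n})

  record Consistent (t : ℕ) (as : List ℕ) : Set where
    constructor consistent
    field
      path   : ℕ → Vx
      isWalk : IsRobberWalk G path
      resp   : Resp G σ path t as
  open Consistent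

  record Ambiguous (t : ℕ) (as : List ℕ) : Set where
    field
      robber₁ robber₂ : Consistent t as
      apart           : path robber₁ t ≢ path robber₂ t

  record Parked (t : ℕ) (as : List ℕ) : Set where
    field
      robber₁ robber₂ : Consistent t as
      a₁ a₂           : Fin n
      at₁             : path robber₁ t ≡ orig a₁
      at₂             : path robber₂ t ≡ orig a₂
      a₁≢a₂           : a₁ ≢ a₂

  outbound : (ℕ → Vx) → ℕ → Fin n → Fin n → ℕ → Vx
  outbound w s x y = switch w s (onPath x y)

  -- Heading towards y, but turning back halfway so as to be home at time m:
  -- after i steps the robber is at position i or m - i, and a probe
  -- touching neither x nor y cannot tell these apart (Dist-reflect).
  retrace : ℕ → ℕ
  retrace i = i ⊓ (m ∸ i)

  returning : (ℕ → Vx) → ℕ → Fin n → Fin n → ℕ → Vx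
  returning w s x y = switch w s (onPath x y ∘ retrace)

  retrace-near : ∀ i → Near (retrace i) (retrace (suc i))
  retrace-near i = ℕP.⊓-mono-≤ (ℕP.≤-trans (ℕP.n≤1+n i) (ℕP.n≤1+n (suc i))) back ,
                   ℕP.⊓-mono-≤ ℕP.≤-refl (ℕP.≤-trans (ℕP.∸-monoʳ-≤ m (ℕP.n≤1+n i)) (ℕP.n≤1+n (m ∸ i)))
    where
    back : m ∸ i ≤ suc (m ∸ suc i)
    back = subst (λ z → m ∸ i ≤ suc z) (ℕP.pred[m∸n]≡m∸[1+n] m i) (ℕP.m≤n+m∸n (m ∸ i) 1)

  retrace-one : M ≢ 0 → retrace 1 ≡ 1
  retrace-one M≢0 = ℕP.m≤n⇒m⊓n≡m (ℕP.n≢0⇒n>0 M≢0)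

  retrace-home : retrace m ≡ 0
  retrace-home = trans (cong (m ⊓_) (ℕP.n∸n≡0 m)) (ℕP.⊓-zeroʳ m)

  outbound-walk : ∀ {w s x y} → IsRobberWalk G w → w s ≡ orig x → x ≢ y →
                  IsRobberWalk G (outbound w s x y)
  outbound-walk w-walk at x≢y = switch-walk w-walk at (onPath-step x≢y)

  returning-walk : ∀ {w s x y} → IsRobberWalk G w → w s ≡ orig x → x ≢ y →
                   IsRobberWalk G (returning w s x y)
  returning-walk w-walk at x≢y = switch-walk w-walk at (λ i → onPath-near x≢y (retrace-near i))

  survivors : Vx → List (Fin n) → List (Fin n)
  survivors p = remove₂ (proj₁ (ends p)) (proj₂ (ends p))

  ∈-survivors : ∀ {y} p L → y ∈ survivors p L → y ∈ L × Untouched y p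
  ∈-survivors p = ∈-remove₂⁻ (proj₁ (ends p)) (proj₂ (ends p))

  commonAnswer : ∀ p x i L → All (_≢ x) L → 1 ≤ length (survivors p L) →
                 Σ ℕ λ d → ∀ {y} → y ∈ survivors p L → Dist G p (onPath x y i) d
  commonAnswer p x i L x∉L nonempty = proj₁ (dist p (onPath x y₀ i)) , λ y∈ →
    Dist-exchange-target i (x≢ y₀∈) (x≢ y∈) (proj₂ (∈-survivors p L y₀∈)) (proj₂ (∈-survivors p L y∈))
                         (proj₂ (dist p (onPath x y₀ i)))
    where
    y₀ = proj₁ (pickOne (survivors p L) nonempty)
    y₀∈ = proj₂ (pickOne (survivors p L) nonempty)
    x≢ : ∀ {y} → y ∈ survivors p L → x ≢ y
    x≢ y∈ = ≢-sym (All.lookup x∉L (proj₁ (∈-survivors p L y∈)))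

  -- A robber who left the original vertex x at time s and has walked j steps
  -- towards a target not yet revealed.  Every target in U explains the
  -- answers; the reserve guarantees candidates for the remaining m - j
  -- probes, possibly with the alternative of returning home.
  record Journey (t : ℕ) (as : List ℕ) : Set where
    field
      s j           : ℕ
      t≡s+j         : t ≡ s + j
      1≤j           : 1 ≤ j
      j≤m           : j ≤ m
      x             : Fin n
      w             : ℕ → Vx
      w-walk        : IsRobberWalk G w
      w-at          : w s ≡ orig x
      U             : List (Fin n)
      U-unique      : Unique U
      x∉U           : All (_≢ x) U
      outbound-resp : ∀ {y} → y ∈ U → Resp G σ (outbound w s x y) t as
      reserve       : Reserve (m ∸ j) U (∀ {y} → y ∈ U → Resp G σ (returning w s x y) t as)

  module _ {t as} (J : Journey t as) where
    open Journey J

    x≢candidate : ∀ {y} → y ∈ U → x ≢ y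
    x≢candidate y∈U = ≢-sym (All.lookup x∉U y∈U)

    heading : ∀ {y} → y ∈ U → Consistent t as
    heading {y} y∈U =
      consistent (outbound w s x y) (outbound-walk w-walk w-at (x≢candidate y∈U)) (outbound-resp y∈U)

    heading-at : ∀ {y} (y∈U : y ∈ U) → path (heading y∈U) t ≡ onPath x y j
    heading-at {y} _ = switch-at {w = w} {f = onPath x y} w-at t≡s+j

  wait : ∀ {t as v d} (R : Consistent t as) → path R t ≡ v → Dist G (σ as) v d →
         Σ (Consistent (suc t) (d ∷ as)) λ R' → path R' (suc t) ≡ v
  wait {t} {v = v} R at dd =
    consistent (switch (path R) t (λ _ → v)) (switch-walk (isWalk R) at (λ _ → inj₁ refl))
               (Resp-switch (resp R) at dd) ,
    switch-at {w = path R} {f = λ _ → v} at (ℕP.+-comm 1 t)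

  -- A robber resting at x, where the probe touches x, sets off along an edge
  -- of x.  Targets untouched by the probe cannot be told apart; at most one
  -- further vertex is touched, leaving 2(m-1)+1 candidates.  For m ≥ 2 the
  -- option of turning back is also consistent, while for m = 1 the probe
  -- touches only x and 2 candidates remain.
  depart : ∀ {t as} (R : Consistent t as) x → path R t ≡ orig x → Touched x (σ as) →
           Σ ℕ λ d → Journey (suc t) (d ∷ as)
  depart {t} {as} R x at x-touched = d , record
    { s = t ; j = 1 ; t≡s+j = ℕP.+-comm 1 t ; j≤m = s≤s z≤n ; 1≤j = s≤s z≤n
    ; x = x ; w = path R ; w-walk = isWalk R ; w-at = at
    ; U = U ; U-unique = remove₂-unique others-unique ; x∉U = remove₂-all others-avoid-x
    ; outbound-resp = λ y∈U → Resp-switch (resp R) at (first-step y∈U)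
    ; reserve = reserve (M ℕ.≟ 0) }
    where
    p = σ as
    others = remove x (allFin n)
    others-avoid-x : All (_≢ x) others
    others-avoid-x = remove-≢ (allFin n)
    others-unique : Unique others
    others-unique = remove-unique (Unique.allFin⁺ n)
    n≤1+others : n ≤ 1 + length others
    n≤1+others = subst (_≤ 1 + length others) (length-tabulate _) (remove-length (allFin n) (Unique.allFin⁺ n))
    U = survivors p others
    U-large : 2 * M + 1 ≤ length U
    U-large = lose-two {q = M} {c = 1} (subst (_≤ n) (ℕP.+-comm 1 (2 * m)) 2m<n)
                (ℕP.≤-trans n≤1+others (s≤s (remove₂-length-absent others others-unique others-avoid-x x-touched)))
    answer = commonAnswer p x 1 others others-avoid-x (ℕP.≤-trans (ℕP.m≤n+m 1 (2 * M)) U-large)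
    d = proj₁ answer
    first-step : ∀ {y} → y ∈ U → Dist G p (onPath x y 1) d
    first-step = proj₂ answer
    reserve : Dec (M ≡ 0) → Reserve M U (∀ {y} → y ∈ U → Resp G σ (returning (path R) t x y) (suc t) (d ∷ as))
    reserve (no M≢0)   = inj₂ (U-large , λ {y} y∈U → Resp-switch (resp R) at
                           (subst (λ i → Dist G p (onPath x y i) d) (sym (retrace-one M≢0)) (first-step y∈U)))
    reserve (yes refl) with touched-diagonal refl {p = p} x-touched
    ... | e₁ , e₂ = inj₁ (subst (λ L → 2 ≤ length L) (sym (remove₂-absent others (x-free e₁) (x-free e₂)))
                                (ℕP.≤-pred (ℕP.≤-trans 2m<n n≤1+others)))
      where
      x-free : ∀ {c} → c ≡ x → All (_≢ c) others
      x-free refl = others-avoid-x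

  -- The probe removes at most two candidates,
  -- or only one if it touches the home vertex x (which is no candidate); in
  -- the latter case the option of returning is dropped, otherwise it stays
  -- consistent because positions j and m - j look alike from the probe.
  continue : ∀ {t as} (J : Journey t as) → Journey.j J < m → Σ ℕ λ d → Journey (suc t) (d ∷ as)
  continue {t} {as} J j<m = d , record
    { s = s ; j = suc j ; t≡s+j = later ; j≤m = j<m ; 1≤j = s≤s z≤n
    ; x = x ; w = w ; w-walk = w-walk ; w-at = w-at
    ; U = U' ; U-unique = remove₂-unique U-unique ; x∉U = remove₂-all x∉U
    ; outbound-resp = λ {y} y∈U' →
        next (outbound-resp (proj₁ (∈-survivors p U y∈U')))
             (subst (λ v → Dist G p v d) (sym (switch-at {w = w} {f = onPath x y} w-at later)) (next-step y∈U'))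
    ; reserve = reserve-map {k = q} {U = U'} keep-returning counted }
    where
    open Journey J
    p = σ as
    q = m ∸ suc j
    U' = survivors p U
    later : suc t ≡ s + suc j
    later = trans (cong suc t≡s+j) (sym (ℕP.+-suc s j))
    Returning : Set
    Returning = ∀ {y} → y ∈ U → Resp G σ (returning w s x y) t as
    counted : Reserve q U' (Untouched x p × Returning)
    counted with subst (λ k → Reserve k U Returning) (∸-suc j<m) reserve | touched? x p
    ... | inj₁ enough         | _           = inj₁ (lose-two {q = q} enough (remove₂-length U U-unique))
    ... | inj₂ (enough , _)   | inj₁ x-hit  = inj₁ (lose-one {q = q} enough (remove₂-length-absent U U-unique x∉U x-hit))
    ... | inj₂ (enough , ret) | inj₂ x-free = inj₂ (lose-two {q = q} enough (remove₂-length U U-unique) , x-free , ret)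
    answer = commonAnswer p x (suc j) U x∉U (ℕP.≤-trans (ℕP.m≤n+m 1 _) (reserve-length {k = q} {U = U'} counted))
    d = proj₁ answer
    next-step : ∀ {y} → y ∈ U' → Dist G p (onPath x y (suc j)) d
    next-step = proj₂ answer
    turning : Untouched x p → ∀ {y} → y ∈ U' → Dist G p (onPath x y (retrace (suc j))) d
    turning x-free {y} y∈U' with ℕP.⊓-sel (suc j) (m ∸ suc j)
    ... | inj₁ e = subst (λ i → Dist G p (onPath x y i) d) (sym e) (next-step y∈U')
    ... | inj₂ e = subst (λ i → Dist G p (onPath x y i) d) (sym e)
                     (Dist-reflect (suc j) j<m (x≢candidate J (proj₁ (∈-survivors p U y∈U'))) x-free
                                   (proj₂ (∈-survivors p U y∈U')) (next-step y∈U'))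
    keep-returning : Untouched x p × Returning → ∀ {y} → y ∈ U' → Resp G σ (returning w s x y) (suc t) (d ∷ as)
    keep-returning (x-free , ret) {y} y∈U' =
      next (ret (proj₁ (∈-survivors p U y∈U')))
           (subst (λ v → Dist G p v d) (sym (switch-at {w = w} {f = onPath x y ∘ retrace} w-at later))
                  (turning x-free y∈U'))

  -- At the end of a journey (j = m) the robber is parked again: at two
  -- distinct targets, or at one target and back home at x.
  settle : ∀ {t as} (J : Journey t as) → Journey.j J ≡ m → Parked t as
  settle {t} {as} J j≡m = parkWith (subst (λ k → Reserve k U Returning) m∸j≡0 reserve)
    where
    open Journey J
    Returning : Set
    Returning = ∀ {y} → y ∈ U → Resp G σ (returning w s x y) t as
    m∸j≡0 : m ∸ j ≡ 0
    m∸j≡0 = trans (cong (m ∸_) j≡m) (ℕP.n∸n≡0 m)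
    arrived : ∀ {y} (y∈U : y ∈ U) → path (heading J y∈U) t ≡ orig y
    arrived {y} y∈U = trans (heading-at J y∈U) (trans (cong (onPath x y) j≡m) onPath-end)
    parkWith : Reserve 0 U Returning → Parked t as
    parkWith (inj₁ two) with pickTwo U U-unique two
    ... | y₁ , y₂ , y₁∈U , y₂∈U , y₁≢y₂ = record
      { robber₁ = heading J y₁∈U ; robber₂ = heading J y₂∈U ; a₁ = y₁ ; a₂ = y₂
      ; at₁ = arrived y₁∈U ; at₂ = arrived y₂∈U ; a₁≢a₂ = y₁≢y₂ }
    parkWith (inj₂ (one , ret)) with pickOne U one
    ... | y , y∈U = record
      { robber₁ = heading J y∈U
      ; robber₂ = consistent (returning w s x y) (returning-walk w-walk w-at (x≢candidate J y∈U)) (ret y∈U)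
      ; a₁ = y ; a₂ = x
      ; at₁ = arrived y∈U
      ; at₂ = trans (switch-at {w = w} {f = onPath x y ∘ retrace} w-at (trans t≡s+j (cong (s +_) j≡m)))
                    (cong (onPath x y) retrace-home)
      ; a₁≢a₂ = All.lookup x∉U y∈U }

  State : ℕ → List ℕ → Set
  State t as = Parked t as ⊎ Σ (Journey t as) (λ J → Journey.j J < m)

  close : ∀ {t as} → Journey t as → State t as
  close J with Journey.j J ℕ.<? m
  ... | yes j<m = inj₂ (J , j<m)
  ... | no  j≮m = inj₁ (settle J (ℕP.≤-antisym (Journey.j≤m J) (ℕP.≮⇒≥ j≮m)))

  stay : ∀ {t as} (P : Parked t as) → Untouched (Parked.a₁ P) (σ as) → Untouched (Parked.a₂ P) (σ as) →
         Σ ℕ λ d → Parked (suc t) (d ∷ as)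
  stay {t} {as} P free₁ free₂ = d , record
    { robber₁ = proj₁ waited₁ ; robber₂ = proj₁ waited₂ ; a₁ = a₁ ; a₂ = a₂
    ; at₁ = proj₂ waited₁ ; at₂ = proj₂ waited₂ ; a₁≢a₂ = a₁≢a₂ }
    where
    open Parked P
    answer = dist (σ as) (orig a₁)
    d = proj₁ answer
    waited₁ = wait robber₁ at₁ (proj₂ answer)
    waited₂ = wait robber₂ at₂ (Dist-exchange-ends free₁ free₂ (proj₂ answer))

  advance : ∀ {t as} → State t as → Σ ℕ λ d → State (suc t) (d ∷ as)
  advance {t} {as} (inj₁ P) = fromParked (touched? a₁ (σ as)) (touched? a₂ (σ as))
    where
    open Parked P
    fromParked : Touched a₁ (σ as) ⊎ Untouched a₁ (σ as) → Touched a₂ (σ as) ⊎ Untouched a₂ (σ as) →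
                 Σ ℕ λ d → State (suc t) (d ∷ as)
    fromParked (inj₁ hit₁)  _            = map₂ close (depart robber₁ a₁ at₁ hit₁)
    fromParked (inj₂ _)     (inj₁ hit₂)  = map₂ close (depart robber₂ a₂ at₂ hit₂)
    fromParked (inj₂ free₁) (inj₂ free₂) = map₂ inj₁ (stay P free₁ free₂)
  advance (inj₂ (J , j<m)) = map₂ close (continue J j<m)

  parked-ambiguous : ∀ {t as} → Parked t as → Ambiguous t as
  parked-ambiguous P = record
    { robber₁ = robber₁ ; robber₂ = robber₂
    ; apart = λ same → a₁≢a₂ (orig-injective (trans (sym at₁) (trans same at₂))) }
    where open Parked P

  -- Strictly inside the edges at least 2(m-j)+1 ≥ 2 candidates remain, and
  -- distinct targets mean distinct positions.
  journey-ambiguous : ∀ {t as} (J : Journey t as) → Journey.j J < m → Ambiguous t as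
  journey-ambiguous J j<m =
    let (y₁ , y₂ , y₁∈U , y₂∈U , y₁≢y₂) = pickTwo U U-unique U-long in record
    { robber₁ = heading J y₁∈U ; robber₂ = heading J y₂∈U
    ; apart = λ same → y₁≢y₂ (onPath-injective j 1≤j j<m (x≢candidate J y₁∈U) (x≢candidate J y₂∈U)
                                (trans (sym (heading-at J y₁∈U)) (trans same (heading-at J y₂∈U)))) }
    where
    open Journey J
    U-long : 2 ≤ length U
    U-long = ℕP.≤-trans (ℕP.*-monoʳ-≤ 2 (ℕP.m<n⇒0<n∸m j<m))
                        (ℕP.≤-trans (ℕP.m≤m+n _ 1) (reserve-length {k = m ∸ j} {U = U} reserve))

  ambiguity : ∀ {t as} → State t as → Ambiguous t as
  ambiguity (inj₁ P)         = parked-ambiguous P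
  ambiguity (inj₂ (J , j<m)) = journey-ambiguous J j<m

  ambiguous⇒unlocated : ∀ {t as r} → Ambiguous t as → Resp G σ r t as → ¬ CopWinsAt G σ r t
  ambiguous⇒unlocated {as = as} A r-resp located =
    apart (trans (located as r-resp (path robber₁) (isWalk robber₁) (resp robber₁))
                 (sym (located as r-resp (path robber₂) (isWalk robber₂) (resp robber₂))))
    where open Ambiguous A

  start : State 0 []
  start = inj₁ record
    { robber₁ = resting a₁ ; robber₂ = resting a₂ ; a₁ = a₁ ; a₂ = a₂
    ; at₁ = refl ; at₂ = refl ; a₁≢a₂ = a₁≢a₂ }
    where
    0<n : 0 < n
    0<n = ℕP.≤-trans (s≤s z≤n) 2m<n
    1<n : 1 < n
    1<n = ℕP.≤-trans (s≤s (s≤s z≤n)) 2m<n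
    a₁ a₂ : Fin n
    a₁ = fromℕ< 0<n
    a₂ = fromℕ< 1<n
    a₁≢a₂ : a₁ ≢ a₂
    a₁≢a₂ e = ℕP.0≢1+n (trans (sym (toℕ-fromℕ< 0<n)) (trans (cong toℕ e) (toℕ-fromℕ< 1<n)))
    resting : Fin n → Consistent 0 []
    resting a = consistent (λ _ → orig a) (λ _ → inj₁ refl) none

  play : ∀ t → Σ (List ℕ) (State t)
  play zero    = [] , start
  play (suc t) = proj₁ (advance (proj₂ (play t))) ∷ proj₁ (play t) , proj₂ (advance (proj₂ (play t)))

  answers : ℕ → List ℕ
  answers t = proj₁ (play t)

  Resp-earlier : ∀ {r} t T → t ≤ T → Resp G σ r T (answers T) → Resp G σ r t (answers t)
  Resp-earlier t zero z≤n resp = resp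
  Resp-earlier t (suc T) t≤1+T resp@(next earlier _) with ℕP.m≤n⇒m<n∨m≡n t≤1+T
  ... | inj₁ t<1+T = Resp-earlier t T (ℕP.≤-pred t<1+T) earlier
  ... | inj₂ refl  = resp

  robberWins : ∀ T → Σ (ℕ → Vx) λ r → IsRobberWalk G r × (∀ t → t ≤ T → ¬ CopWinsAt G σ r t)
  robberWins T = path R , isWalk R , λ t t≤T →
    ambiguous⇒unlocated (ambiguity (proj₂ (play t))) (Resp-earlier t T t≤T (resp R))
    where R = Ambiguous.robber₁ (ambiguity (proj₂ (play T)))

mainTheorem3 : (n m : ℕ) → 2 ≤ n → 1 ≤ m → 2 * m < n → ¬ Locatable (KSub n m)
mainTheorem3 n zero    _ () _
mainTheorem3 n (suc M) _ _ 2m<n (σ , T , locates) =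
  let (r , r-walk , unlocated) = Robber.robberWins n M 2m<n σ T
      (t , t≤T , located)      = locates r r-walk
  in  unlocated t t≤T located
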